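{- Suppose that $I$ and $K$ are independent sets internally related to a basis $C$ with $K\not\leq_{ext/int} I$. Let $c\in K\setminus I$ (such an element exists and lies in $\mathrm{IA}(C)$) and let $J:=K\setminus c$. Then, \begin{enumerate} \item $J <_{ext/int} K$; in particular $J$ precedes $K$ in any linear extension of $\leq_{ext/int}$. \item $F(I)\cap F(K) \subset F(J)\cap F(K) = F(K)\setminus z_c$. \end{enumerate}
   Context: Let $M$ be a matroid on a finite ground set $E$ with a fixed linear order $<$. For $S\subseteq E$, $\mathrm{EA}(S)$ ($\mathrm{EP}(S)$) is the set of $e\in E\setminus S$ which are (are not) the maximum element of a circuit contained in $S\cup e$; $\mathrm{IA}(S)$ is the set of $i\in S$ externally active with respect to $E\setminus S$ in the dual matroid $M^\perp$, and $\mathrm{IP}(S)=S\setminus\mathrm{IA}(S)$. Every independent set $I$ is uniquely $I=B\setminus Y$ with $B$ a basis and $Y\subseteq\mathrm{IA}(B)$; $I$ is then internally related to $B$, and two independent sets are internally related if related to the same basis. The external/internal order on independent sets: $I\leq_{ext/int}J$ iff either $I,J$ are not internally related and $(I\setminus\mathrm{IA}(I))\cup\mathrm{EA}(I)\subseteq (J\setminus\mathrm{IA}(J))\cup\mathrm{EA}(J)$, or they are internally related and $I\subseteq J$. The augmented external activity complex $\Delta_M$ has ground set $\{x_e,y_e,z_e:e\in E\}$ and facets $F(I)=x_{I\cup\mathrm{EP}(I)}\,y_Y\,z_{I\cup\mathrm{EA}(I)}$ for each independent $I=B\setminus Y$, with $x_S=\{x_i:i\in S\}$ and juxtaposition meaning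 union. In this setting $J=K\setminus c$ is internally related to $C$ and $c\in\mathrm{EP}(I)$. -}

module Defs where

open import Data.Nat using (ℕ; _<_)
open import Data.Fin using (Fin) renaming (_≤_ to _≤ᶠ_)
open import Data.Fin.Subset using (Subset; _∈_; _∉_; _⊆_; _∪_; _─_; ⁅_⁆; ∁; ∣_∣; ⊥)
open import Data.Product using (Σ; ∃; _×_; _,_)
open import Data.Sum using (_⊎_)
open import Relation.Nullary using (¬_; Dec)
open import Relation.Binary.PropositionalEquality using (_≡_; _≢_)

-- A matroid on the ground set E = Fin n, linearly ordered by the usual order
-- of Fin n, given by its independent sets (finite matroid, decidable independence).
record Matroid (n : ℕ) : Set₁ where
  field
    Indep        : Subset n → Set
    indep?       : (S : Subset n) → Dec (Indep S)
    indep-empty  : Indep ⊥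
    indep-subset : ∀ {S T} → S ⊆ T → Indep T → Indep S
    indep-augment : ∀ {S T} → Indep S → Indep T → ∣ S ∣ < ∣ T ∣ →
                    ∃ λ x → x ∈ T × x ∉ S × Indep (S ∪ ⁅ x ⁆)

module _ {n : ℕ} where

  Circuit : (Subset n → Set) → Subset n → Set
  Circuit Ind D = ¬ Ind D × (∀ x → x ∈ D → Ind (D ─ ⁅ x ⁆))

  IsBasis : (Subset n → Set) → Subset n → Set
  IsBasis Ind B = Ind B × (∀ x → x ∉ B → ¬ Ind (B ∪ ⁅ x ⁆))

  ExtActive : (Subset n → Set) → Subset n → Fin n → Set
  ExtActive Ind S e =
    e ∉ S × ∃ λ D → Circuit Ind D × D ⊆ (S ∪ ⁅ e ⁆) × e ∈ D × (∀ x → x ∈ D → x ≤ᶠ e)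

  ExtPassive : (Subset n → Set) → Subset n → Fin n → Set
  ExtPassive Ind S e = e ∉ S × ¬ ExtActive Ind S e

module _ {n : ℕ} (M : Matroid n) where
  open Matroid M

  Basis : Subset n → Set
  Basis = IsBasis Indep

  DualIndep : Subset n → Set
  DualIndep T = ∃ λ B → Basis B × T ⊆ ∁ B

  EA : Subset n → Fin n → Set
  EA = ExtActive Indep

  EP : Subset n → Fin n → Set
  EP = ExtPassive Indep

  IA : Subset n → Fin n → Set
  IA S i = i ∈ S × ExtActive DualIndep (∁ S) i

  IP : Subset n → Fin n → Set
  IP S i = i ∈ S × ¬ IA S i

  InternallyRelatedTo : Subset n → Subset n → Set
  InternallyRelatedTo I B =
    Basis B × ∃ λ Y → (∀ i → i ∈ Y → IA B i) × I ≡ B ─ Y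

  InternallyRelated : Subset n → Subset n → Set
  InternallyRelated I J = ∃ λ B → InternallyRelatedTo I B × InternallyRelatedTo J B

  ActSet : Subset n → Fin n → Set
  ActSet I e = (e ∈ I × ¬ IA I e) ⊎ EA I e

  _≤ext/int_ : Subset n → Subset n → Set
  I ≤ext/int J =
    (¬ InternallyRelated I J × (∀ e → ActSet I e → ActSet J e))
    ⊎ (InternallyRelated I J × I ⊆ J)

  _<ext/int_ : Subset n → Subset n → Set
  I <ext/int J = I ≤ext/int J × I ≢ J

data Var : Set where
  x y z : Var

Vertex : ℕ → Set
Vertex n = Var × Fin n

module _ {n : ℕ} (M : Matroid n) where
  open Matroid M

  -- F(I) = x_{I ∪ EP(I)} y_Y z_{I ∪ EA(I)}  where I = B ∖ Y, Y ⊆ IA(B)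
  InFacet : Subset n → Vertex n → Set
  InFacet I (x , e) = e ∈ I ⊎ EP M I e
  InFacet I (y , e) = ∃ λ B → ∃ λ Y → Basis M B × (∀ i → i ∈ Y → IA M B i)
                        × I ≡ B ─ Y × e ∈ Y
  InFacet I (z , e) = e ∈ I ⊎ EA M I e

{-# OPTIONS --safe #-}
module Submission where

-- I and K are both obtained from C by deleting internally active elements, so K ≰ I forces
-- some c ∈ K ∖ I, which is then internally active in C; hence J = K ∖ c is again internally
-- related to C and J ⊊ K. F(J) ∩ F(K) = F(K) ∖ z_c because EA(J) and EA(K) agree outside K:
-- a circuit with maximum e ∉ K cannot contain c, since the cocircuit witnessing the activity
-- of c would meet it in a second element, forcing e = c. The same circuit–cocircuit
-- orthogonality shows that the basis B in K = B ∖ Y is unique, which is what the y-vertices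
-- of F(K) need.

open import Defs
open import Data.Nat using (ℕ)
open import Data.Fin using (Fin)
open import Data.Fin.Subset using (Subset; _∈_; _∉_; _─_; ⁅_⁆)
open import Data.Product using (∃; _×_; _,_)
open import Relation.Nullary using (¬_)
open import Relation.Binary.PropositionalEquality using (_≢_)

open import Data.Empty using (⊥; ⊥-elim)
open import Data.Fin using (_≟_)
open import Data.Fin.Properties using (≤-antisym; any?)
open import Data.Fin.Subset using (_⊆_; _∪_; ∁; ∣_∣; inside; outside)
open import Data.Fin.Subset.Properties
open import Data.List using ([]; _∷_; foldr; allFin)
open import Data.List.Membership.Propositional using () renaming (_∈_ to _∈ˡ_)
open import Data.List.Membership.Propositional.Properties using (∈-allFin)
open import Data.List.Relation.Unary.Any using (here; there)
open import Data.Nat using (_<_)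
open import Data.Nat.Properties using (≮⇒≥; ≤-<-trans)
open import Data.Product using (proj₁)
open import Data.Sum using (_⊎_; inj₁; inj₂)
open import Data.Vec using (_∷_; here; there)
open import Relation.Nullary using (yes; no; ¬?)
open import Relation.Nullary.Decidable using (_×-dec_; decidable-stable)
open import Relation.Binary.PropositionalEquality using (_≡_; refl; sym; trans; cong; subst)

private
  variable
    n : ℕ
    p q : Subset n
    i j : Fin n

i∈p─q⇒i∉q : ∀ (p q : Subset n) → i ∈ p ─ q → i ∉ q
i∈p─q⇒i∉q (_ ∷ p) (inside ∷ q)  ()        here
i∈p─q⇒i∉q (_ ∷ p) (outside ∷ q) here      ()
i∈p─q⇒i∉q (_ ∷ p) (_ ∷ q)       (there m) (there m') = i∈p─q⇒i∉q p q m m'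

i∈p-j⇒i≢j : i ∈ p ─ ⁅ j ⁆ → i ≢ j
i∈p-j⇒i≢j {p = p} {j = j} m = x∉⁅y⁆⇒x≢y (i∈p─q⇒i∉q p ⁅ j ⁆ m)

i∉p-i : i ∉ p ─ ⁅ i ⁆
i∉p-i m = i∈p-j⇒i≢j m refl

i∈p∪⁅j⁆⁻ : i ∈ p ∪ ⁅ j ⁆ → i ∈ p ⊎ i ≡ j
i∈p∪⁅j⁆⁻ {p = p} {j = j} m with x∈p∪q⁻ p ⁅ j ⁆ m
... | inj₁ i∈p = inj₁ i∈p
... | inj₂ i∈j = inj₂ (x∈⁅y⁆⇒x≡y j i∈j)

i∈p∪⁅j⁆∧i≢j⇒i∈p : i ∈ p ∪ ⁅ j ⁆ → i ≢ j → i ∈ p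
i∈p∪⁅j⁆∧i≢j⇒i∈p m i≢j with i∈p∪⁅j⁆⁻ m
... | inj₁ i∈p = i∈p
... | inj₂ i≡j = ⊥-elim (i≢j i≡j)

i∈p∧i∉p─q⇒i∈q : i ∈ p → i ∉ p ─ q → i ∈ q
i∈p∧i∉p─q⇒i∈q {i = i} {q = q} i∈p i∉p─q =
  decidable-stable (i ∈? q) (λ i∉q → i∉p─q (x∈p∧x∉q⇒x∈p─q i∈p i∉q))

j∈p∪⁅j⁆ : j ∈ p ∪ ⁅ j ⁆
j∈p∪⁅j⁆ {j = j} {p = p} = q⊆p∪q p ⁅ j ⁆ (x∈⁅x⁆ j)

i∈p⇒i∈p∪⁅j⁆ : i ∈ p → i ∈ p ∪ ⁅ j ⁆
i∈p⇒i∈p∪⁅j⁆ {j = j} = p⊆p∪q ⁅ j ⁆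

p⊆q∧j∈q⇒p∪⁅j⁆⊆q : p ⊆ q → j ∈ q → p ∪ ⁅ j ⁆ ⊆ q
p⊆q∧j∈q⇒p∪⁅j⁆⊆q p⊆q j∈q m with i∈p∪⁅j⁆⁻ m
... | inj₁ i∈p  = p⊆q i∈p
... | inj₂ refl = j∈q

p-j⊆q∧j∈q⇒p⊆q : p ─ ⁅ j ⁆ ⊆ q → j ∈ q → p ⊆ q
p-j⊆q∧j∈q⇒p⊆q {j = j} p-j⊆q j∈q {i} i∈p with i ≟ j
... | yes refl = j∈q
... | no i≢j   = p-j⊆q (x∈p∧x≢y⇒x∈p-y i∈p i≢j)

∪⁅⁆-monoˡ : p ⊆ q → p ∪ ⁅ j ⁆ ⊆ q ∪ ⁅ j ⁆
∪⁅⁆-monoˡ p⊆q = p⊆q∧j∈q⇒p∪⁅j⁆⊆q (λ i∈p → i∈p⇒i∈p∪⁅j⁆ (p⊆q i∈p)) j∈p∪⁅j⁆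

p⊈q⇒∃i∈p∧i∉q : ¬ (p ⊆ q) → ∃ λ i → i ∈ p × i ∉ q
p⊈q⇒∃i∈p∧i∉q {p = p} {q = q} p⊈q with any? (λ i → i ∈? p ×-dec ¬? (i ∈? q))
... | yes witness = witness
... | no ¬witness = ⊥-elim (p⊈q (λ {i} i∈p →
        decidable-stable (i ∈? q) (λ i∉q → ¬witness (i , i∈p , i∉q))))

module _ {A B : Set} {f : A → B → B} where

  foldr-invariant : (P : B → Set) → (∀ a {s} → P s → P (f a s)) →
                    ∀ {e} → P e → ∀ xs → P (foldr f e xs)
  foldr-invariant P step Pe []       = Pe
  foldr-invariant P step Pe (w ∷ ws) = step w (foldr-invariant P step Pe ws)

  foldr-established : (Q : A → B → Set) → (∀ a s → Q a (f a s)) →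
                      (∀ a b {s} → Q a s → Q a (f b s)) →
                      ∀ e {a xs} → a ∈ˡ xs → Q a (foldr f e xs)
  foldr-established Q est pres e {xs = w ∷ ws} (here refl) = est w (foldr f e ws)
  foldr-established Q est pres e {xs = w ∷ ws} (there a∈ws) =
    pres _ w (foldr-established Q est pres e a∈ws)

ExtActive-mono : ∀ {Ind : Subset n → Set} {S T e} →
                 S ⊆ T → e ∉ T → ExtActive Ind S e → ExtActive Ind T e
ExtActive-mono S⊆T e∉T (_ , D , circD , D⊆ , e∈D , maxD) =
  e∉T , D , circD , (λ m → ∪⁅⁆-monoˡ S⊆T (D⊆ m)) , e∈D , maxD

module _ (M : Matroid n) where
  open Matroid M

  Cocircuit : Subset n → Set
  Cocircuit = Circuit (DualIndep M)

  private
    shrinkAt : Fin n → Subset n → Subset n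
    shrinkAt a S with indep? (S ─ ⁅ a ⁆)
    ... | yes _ = S
    ... | no _  = S ─ ⁅ a ⁆

    shrinkAt-⊆ : ∀ a S → shrinkAt a S ⊆ S
    shrinkAt-⊆ a S with indep? (S ─ ⁅ a ⁆)
    ... | yes _ = λ m → m
    ... | no _  = p─q⊆p S ⁅ a ⁆

    shrinkAt-dependent : ∀ a {S} → ¬ Indep S → ¬ Indep (shrinkAt a S)
    shrinkAt-dependent a {S} depS with indep? (S ─ ⁅ a ⁆)
    ... | yes _    = depS
    ... | no depS' = depS'

    Minimal : Fin n → Subset n → Set
    Minimal a S = a ∈ S → Indep (S ─ ⁅ a ⁆)

    shrinkAt-minimal : ∀ a S → Minimal a (shrinkAt a S)
    shrinkAt-minimal a S with indep? (S ─ ⁅ a ⁆)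
    ... | yes ind = λ _ → ind
    ... | no _    = λ a∈S-a → ⊥-elim (i∈p-j⇒i≢j a∈S-a refl)

    minimal-⊆ : ∀ {a S T} → T ⊆ S → Minimal a S → Minimal a T
    minimal-⊆ T⊆S minS a∈T =
      indep-subset (λ m → x∈p∧x≢y⇒x∈p-y (T⊆S (p─q⊆p _ _ m)) (i∈p-j⇒i≢j m)) (minS (T⊆S a∈T))

  dependent⇒∃circuit : ∀ {S} → ¬ Indep S → ∃ λ Z → Circuit Indep Z × Z ⊆ S
  dependent⇒∃circuit {S} depS = Z , (depZ , minZ) , Z⊆S
    where
    Z : Subset n
    Z = foldr shrinkAt S (allFin n)

    depZ : ¬ Indep Z
    depZ = foldr-invariant (λ T → ¬ Indep T) shrinkAt-dependent depS (allFin n)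

    Z⊆S : Z ⊆ S
    Z⊆S = foldr-invariant (_⊆ S) (λ a T⊆S m → T⊆S (shrinkAt-⊆ a _ m)) (λ m → m) (allFin n)

    minZ : ∀ a → a ∈ Z → Indep (Z ─ ⁅ a ⁆)
    minZ a = foldr-established Minimal shrinkAt-minimal
               (λ _ b {T} → minimal-⊆ (shrinkAt-⊆ b T)) S (∈-allFin a)

  circuit⊆S∪⁅e⁆⇒e∈circuit : ∀ {S Z e} → Indep S → Circuit Indep Z → Z ⊆ S ∪ ⁅ e ⁆ → e ∈ Z
  circuit⊆S∪⁅e⁆⇒e∈circuit {e = e} indS (depZ , _) Z⊆ = decidable-stable (e ∈? _) λ e∉Z →
    depZ (indep-subset (λ w∈Z → i∈p∪⁅j⁆∧i≢j⇒i∈p (Z⊆ w∈Z) (λ { refl → e∉Z w∈Z })) indS)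

  SaturatedAt : Subset n → Fin n → Subset n → Set
  SaturatedAt B a T = a ∈ B → a ∈ T ⊎ ¬ Indep (T ∪ ⁅ a ⁆)

  Saturated : Subset n → Subset n → Set
  Saturated B T = ∀ a → SaturatedAt B a T

  saturated⇒basis : ∀ {B T} → Basis M B → Indep T → Saturated B T → Basis M T
  saturated⇒basis {B} {T} (indB , maxB) indT satT = indT , maxT
    where
    B≤T : ¬ (∣ T ∣ < ∣ B ∣)
    B≤T T<B with indep-augment indT indB T<B
    ... | a , a∈B , a∉T , ind with satT a a∈B
    ... | inj₁ a∈T = a∉T a∈T
    ... | inj₂ dep = dep ind

    maxT : ∀ a → a ∉ T → ¬ Indep (T ∪ ⁅ a ⁆)
    maxT a a∉T ind
      with indep-augment indB ind
             (≤-<-trans (≮⇒≥ B≤T) (p⊂q⇒∣p∣<∣q∣ (p⊆p∪q ⁅ a ⁆ , a , j∈p∪⁅j⁆ , a∉T)))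
    ... | b , _ , b∉B , ind' = maxB b b∉B ind'

  private
    addFrom : Subset n → Fin n → Subset n → Subset n
    addFrom B a T with a ∈? B ×-dec indep? (T ∪ ⁅ a ⁆)
    ... | yes _ = T ∪ ⁅ a ⁆
    ... | no _  = T

    addFrom-indep : ∀ B a {T} → Indep T → Indep (addFrom B a T)
    addFrom-indep B a {T} indT with a ∈? B ×-dec indep? (T ∪ ⁅ a ⁆)
    ... | yes (_ , ind) = ind
    ... | no _          = indT

    addFrom-⊇ : ∀ B a T → T ⊆ addFrom B a T
    addFrom-⊇ B a T with a ∈? B ×-dec indep? (T ∪ ⁅ a ⁆)
    ... | yes _ = i∈p⇒i∈p∪⁅j⁆
    ... | no _  = λ m → m

    addFrom-⊆ : ∀ {X} B a T → T ⊆ X → B ⊆ X → addFrom B a T ⊆ X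
    addFrom-⊆ B a T T⊆X B⊆X with a ∈? B ×-dec indep? (T ∪ ⁅ a ⁆)
    ... | yes (a∈B , _) = p⊆q∧j∈q⇒p∪⁅j⁆⊆q T⊆X (B⊆X a∈B)
    ... | no _          = T⊆X

    addFrom-saturates : ∀ B a T → SaturatedAt B a (addFrom B a T)
    addFrom-saturates B a T a∈B with a ∈? B ×-dec indep? (T ∪ ⁅ a ⁆)
    ... | yes _ = inj₁ j∈p∪⁅j⁆
    ... | no ¬ok = inj₂ λ ind → ¬ok (a∈B , ind)

    saturatedAt-⊆ : ∀ {B a T U} → T ⊆ U → SaturatedAt B a T → SaturatedAt B a U
    saturatedAt-⊆ T⊆U satT a∈B with satT a∈B
    ... | inj₁ a∈T = inj₁ (T⊆U a∈T)
    ... | inj₂ dep = inj₂ λ ind → dep (indep-subset (∪⁅⁆-monoˡ T⊆U) ind)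

  basis-extension : ∀ {A B} → Indep A → Basis M B → ∃ λ T → Basis M T × A ⊆ T × T ⊆ A ∪ B
  basis-extension {A} {B} indA basisB = T , saturated⇒basis basisB indT satT , A⊆T , T⊆A∪B
    where
    T : Subset n
    T = foldr (addFrom B) A (allFin n)

    indT : Indep T
    indT = foldr-invariant Indep (addFrom-indep B) indA (allFin n)

    A⊆T : A ⊆ T
    A⊆T = foldr-invariant (A ⊆_) (λ a A⊆U m → addFrom-⊇ B a _ (A⊆U m)) (λ m → m) (allFin n)

    T⊆A∪B : T ⊆ A ∪ B
    T⊆A∪B = foldr-invariant (_⊆ A ∪ B) (λ a U⊆ → addFrom-⊆ B a _ U⊆ (q⊆p∪q A B))
              (p⊆p∪q B) (allFin n)

    satT : Saturated B T
    satT a = foldr-established (SaturatedAt B) (addFrom-saturates B)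
               (λ _ b {U} → saturatedAt-⊆ (addFrom-⊇ B b U)) A (∈-allFin a)

  -- Extend Z - e to a basis T inside (Z - e) ∪ Be, where Be avoids D - e: if e ∈ T then the
  -- circuit Z lies in T, otherwise T avoids all of D and D would be dual-independent.
  circuit∩cocircuit≢⁅e⁆ : ∀ {Z D e} → Circuit Indep Z → Cocircuit D → e ∈ Z → e ∈ D →
                           ∃ λ g → g ∈ Z × g ∈ D × g ≢ e
  circuit∩cocircuit≢⁅e⁆ {Z} {D} {e} (depZ , minZ) (depD , minD) e∈Z e∈D
    with any? (λ g → g ∈? Z ×-dec g ∈? D ×-dec ¬? (g ≟ e))
  ... | yes meet = meet
  ... | no ¬meet with minD e e∈D
  ... | Be , basisBe , D-e⊆∁Be with basis-extension (minZ e e∈Z) basisBe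
  ... | T , basisT , Z-e⊆T , T⊆ with e ∈? T
  ... | yes e∈T = ⊥-elim (depZ (indep-subset (p-j⊆q∧j∈q⇒p⊆q Z-e⊆T e∈T) (proj₁ basisT)))
  ... | no e∉T  = ⊥-elim (depD (T , basisT , λ d∈D → x∉p⇒x∈∁p (d∉T d∈D)))
    where
    d∉T : ∀ {d} → d ∈ D → d ∉ T
    d∉T {d} d∈D d∈T with x∈p∪q⁻ (Z ─ ⁅ e ⁆) Be (T⊆ d∈T) | d ≟ e
    ... | _            | yes refl = e∉T d∈T
    ... | inj₁ d∈Z-e   | no d≢e   = ¬meet (d , p─q⊆p Z ⁅ e ⁆ d∈Z-e , d∈D , d≢e)
    ... | inj₂ d∈Be    | no d≢e   = x∈∁p⇒x∉p (D-e⊆∁Be (x∈p∧x≢y⇒x∈p-y d∈D d≢e)) d∈Be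

  circuit-cocircuit-meet-again : ∀ {S Z D e g} → Circuit Indep Z → Cocircuit D →
                               Z ⊆ S ∪ ⁅ e ⁆ → D ⊆ ∁ S ∪ ⁅ g ⁆ → g ∈ Z → g ∈ D → e ∈ D
  circuit-cocircuit-meet-again circZ coD Z⊆ D⊆ g∈Z g∈D
    with circuit∩cocircuit≢⁅e⁆ circZ coD g∈Z g∈D
  ... | h , h∈Z , h∈D , h≢g with i∈p∪⁅j⁆⁻ (Z⊆ h∈Z)
  ... | inj₁ h∈S  = ⊥-elim (x∈∁p⇒x∉p (i∈p∪⁅j⁆∧i≢j⇒i∈p (D⊆ h∈D) h≢g) h∈S)
  ... | inj₂ refl = h∈D

  EA⇒dependent : ∀ {S e} → EA M S e → ¬ Indep (S ∪ ⁅ e ⁆)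
  EA⇒dependent (_ , D , (depD , _) , D⊆ , _) ind = depD (indep-subset D⊆ ind)

  internallyRelatedTo⇒⊆ : ∀ {K B} → InternallyRelatedTo M K B → K ⊆ B
  internallyRelatedTo⇒⊆ {B = B} (_ , Y , _ , refl) = p─q⊆p B Y

  missing⇒IA : ∀ {K B e} → InternallyRelatedTo M K B → e ∈ B → e ∉ K → IA M B e
  missing⇒IA (_ , Y , actY , refl) e∈B e∉K = actY _ (i∈p∧i∉p─q⇒i∈q e∈B e∉K)

  -- An element e ∈ B ∖ C would be internally active in B and g ∈ Z ∩ D ∖ e internally active
  -- in C; the cocircuits witnessing this force e ≤ g ≤ e.
  internallyRelatedTo-⊆ : ∀ {K B C} → InternallyRelatedTo M K B → InternallyRelatedTo M K C → B ⊆ C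
  internallyRelatedTo-⊆ {K} {B} {C} rB rC@((indC , maxC) , _) {e} e∈B =
    decidable-stable (e ∈? C) escape
    where
    escape : e ∉ C → ⊥
    escape e∉C with missing⇒IA rB e∈B (λ e∈K → e∉C (internallyRelatedTo⇒⊆ rC e∈K))
                  | dependent⇒∃circuit (maxC e e∉C)
    ... | _ , _ , D , coD , D⊆ , e∈D , maxD | Z , circZ , Z⊆
      with circuit∩cocircuit≢⁅e⁆ circZ coD (circuit⊆S∪⁅e⁆⇒e∈circuit indC circZ Z⊆) e∈D
    ... | g , g∈Z , g∈D , g≢e
      with missing⇒IA rC (i∈p∪⁅j⁆∧i≢j⇒i∈p (Z⊆ g∈Z) g≢e)
             (λ g∈K → x∈∁p⇒x∉p (i∈p∪⁅j⁆∧i≢j⇒i∈p (D⊆ g∈D) g≢e) (internallyRelatedTo⇒⊆ rB g∈K))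
    ... | _ , _ , D' , coD' , D'⊆ , g∈D' , maxD' =
      g≢e (≤-antisym (maxD g g∈D) (maxD' e (circuit-cocircuit-meet-again circZ coD' Z⊆ D'⊆ g∈Z g∈D')))

  internallyRelatedTo-unique : ∀ {K B C} → InternallyRelatedTo M K B → InternallyRelatedTo M K C → B ≡ C
  internallyRelatedTo-unique rB rC = ⊆-antisym (internallyRelatedTo-⊆ rB rC) (internallyRelatedTo-⊆ rC rB)

  private
    IA-∪⁅⁆ : ∀ {B Y c} → (∀ i → i ∈ Y → IA M B i) → IA M B c → ∀ i → i ∈ Y ∪ ⁅ c ⁆ → IA M B i
    IA-∪⁅⁆ actY actc i m with i∈p∪⁅j⁆⁻ m
    ... | inj₁ i∈Y = actY i i∈Y
    ... | inj₂ refl = actc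

  internallyRelatedTo-─ : ∀ {K C c} → InternallyRelatedTo M K C → IA M C c →
                          InternallyRelatedTo M (K ─ ⁅ c ⁆) C
  internallyRelatedTo-─ {C = C} {c} (basisC , Y , actY , refl) actc =
    basisC , Y ∪ ⁅ c ⁆ , IA-∪⁅⁆ actY actc , p─q─r≡p─q∪r C Y ⁅ c ⁆

  -- A circuit D ⊆ K ∪ e with maximum e cannot contain c: the cocircuit witnessing that c is
  -- internally active would have to contain e too, forcing e = c ∈ K.
  EA-─ : ∀ {K C c e} → K ⊆ C → IA M C c → c ∈ K → EA M K e → EA M (K ─ ⁅ c ⁆) e
  EA-─ {K} {C} {c} {e} K⊆C (_ , _ , D' , coD' , D'⊆ , c∈D' , maxD') c∈K
       (e∉K , D , circD , D⊆ , e∈D , maxD) =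
    (λ m → e∉K (p─q⊆p K ⁅ c ⁆ m)) , D , circD , D⊆K-c∪e , e∈D , maxD
    where
    c∉D : c ∉ D
    c∉D c∈D = e∉K (subst (_∈ K) (≤-antisym (maxD c c∈D) (maxD' e e∈D')) c∈K)
      where
      e∈D' : e ∈ D'
      e∈D' = circuit-cocircuit-meet-again circD coD' (λ m → ∪⁅⁆-monoˡ K⊆C (D⊆ m)) D'⊆ c∈D c∈D'

    D⊆K-c∪e : D ⊆ (K ─ ⁅ c ⁆) ∪ ⁅ e ⁆
    D⊆K-c∪e w∈D with i∈p∪⁅j⁆⁻ (D⊆ w∈D)
    ... | inj₁ w∈K = i∈p⇒i∈p∪⁅j⁆ (x∈p∧x≢y⇒x∈p-y w∈K λ { refl → c∉D w∈D })
    ... | inj₂ refl = j∈p∪⁅j⁆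

  z∉InFacet : ∀ {S C c} → InternallyRelatedTo M S C → c ∈ C → c ∉ S → ¬ InFacet M S (z , c)
  z∉InFacet _ _ c∉S (inj₁ c∈S) = c∉S c∈S
  z∉InFacet rC@((indC , _) , _) c∈C _ (inj₂ act) =
    EA⇒dependent act (indep-subset (p⊆q∧j∈q⇒p∪⁅j⁆⊆q (internallyRelatedTo⇒⊆ rC) c∈C) indC)

  InFacet-y-─ : ∀ {K C c e} → InternallyRelatedTo M K C → IA M C c →
                InFacet M K (y , e) → InFacet M (K ─ ⁅ c ⁆) (y , e)
  InFacet-y-─ {K} {c = c} rC actc (B , Y , basisB , actY , K≡B─Y , e∈Y) =
    B , Y ∪ ⁅ c ⁆ , basisB , IA-∪⁅⁆ actY actcB ,
    trans (cong (_─ ⁅ c ⁆) K≡B─Y) (p─q─r≡p─q∪r B Y ⁅ c ⁆) , i∈p⇒i∈p∪⁅j⁆ e∈Y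
    where
    actcB : IA M B c
    actcB = subst (λ B' → IA M B' c)
              (sym (internallyRelatedTo-unique (basisB , Y , actY , K≡B─Y) rC)) actc

  InFacet-─ : ∀ {K C c v} → InternallyRelatedTo M K C → IA M C c → c ∈ K →
              v ≢ (z , c) → InFacet M K v → InFacet M (K ─ ⁅ c ⁆) v
  InFacet-─ {K} {C} {c} {x , e} rC actc c∈K _ (inj₁ e∈K) with e ≟ c
  ... | yes refl = inj₂ (i∉p-i , λ act → z∉InFacet (internallyRelatedTo-─ rC actc)
                                            (internallyRelatedTo⇒⊆ rC c∈K) i∉p-i (inj₂ act))
  ... | no e≢c = inj₁ (x∈p∧x≢y⇒x∈p-y e∈K e≢c)
  InFacet-─ {K} {c = c} {x , e} _ _ _ _ (inj₂ (e∉K , ¬act)) =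
    inj₂ ((λ m → e∉K (p─q⊆p K ⁅ c ⁆ m)) , λ act → ¬act (ExtActive-mono (p─q⊆p K ⁅ c ⁆) e∉K act))
  InFacet-─ {v = y , e} rC actc _ _ f = InFacet-y-─ rC actc f
  InFacet-─ {v = z , e} _ _ _ v≢zc (inj₁ e∈K) = inj₁ (x∈p∧x≢y⇒x∈p-y e∈K λ { refl → v≢zc refl })
  InFacet-─ {v = z , e} rC actc c∈K _ (inj₂ act) = inj₂ (EA-─ (internallyRelatedTo⇒⊆ rC) actc c∈K act)

lemma5p9 : ∀ {n} (M : Matroid n) (C I K : Subset n) →
    Basis M C → InternallyRelatedTo M I C → InternallyRelatedTo M K C →
    ¬ (_≤ext/int_ M K I) →
    (∃ λ c → c ∈ K × c ∉ I) ×
    (∀ c → c ∈ K → c ∉ I →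
      IA M C c ×
      _<ext/int_ M (K ─ ⁅ c ⁆) K ×
      (∀ v → InFacet M I v × InFacet M K v → InFacet M (K ─ ⁅ c ⁆) v × InFacet M K v) ×
      (∀ v → InFacet M (K ─ ⁅ c ⁆) v × InFacet M K v → InFacet M K v × v ≢ (z , c)) ×
      (∀ v → InFacet M K v × v ≢ (z , c) → InFacet M (K ─ ⁅ c ⁆) v × InFacet M K v))
lemma5p9 M C I K _ rI rK K≰I =
  p⊈q⇒∃i∈p∧i∉q (λ K⊆I → K≰I (inj₂ ((C , rK , rI) , K⊆I))) , λ c c∈K c∉I →
    let c∈C : c ∈ C
        c∈C = internallyRelatedTo⇒⊆ M rK c∈K
        actc : IA M C c
        actc = missing⇒IA M rI c∈C c∉I
        rJ : InternallyRelatedTo M (K ─ ⁅ c ⁆) C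
        rJ = internallyRelatedTo-─ M rK actc
    in actc
     , (inj₂ ((C , rJ , rK) , p─q⊆p K ⁅ c ⁆) , λ J≡K → i∉p-i (subst (c ∈_) (sym J≡K) c∈K))
     , (λ { v (fI , fK) → InFacet-─ M rK actc c∈K (λ { refl → z∉InFacet M rI c∈C c∉I fI }) fK , fK })
     , (λ { v (fJ , fK) → fK , λ { refl → z∉InFacet M rJ c∈C i∉p-i fJ } })
     , (λ { v (fK , v≢zc) → InFacet-─ M rK actc c∈K v≢zc fK , fK })
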